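{- Let $\mathcal{S}_1$ and $\mathcal{S}_2$ be spanoids on the sets $U_1$ and $U_2$ respectively. Let $M_1,\ldots,M_s\subseteq U_1$ and $N_1,\ldots,N_s\subseteq U_2$ be sets such that for every $i\in U_1$, the span in $\mathcal{S}_2$ of $\bigcup_{j:\, i\in M_j}N_j$ equals $U_2$. Then $R(\mathcal{S}_1\otimes\mathcal{S}_2)\le\sum_{t=1}^s|M_t|\cdot|N_t|$.
   Context: A spanoid $\mathcal{S}$ over a finite set $U$ is a family of pairs $(S,i)$ with $S\subseteq U$, $i\in U$; it is assumed that $(\{i\},i)\in\mathcal{S}$ for all $i$ and that $(S,i)\in\mathcal{S}$ implies $(S',i)\in\mathcal{S}$ for $S\subseteq S'\subseteq U$. A derivation of $i$ from $T\subseteq U$ is a sequence $T=T_0,\ldots,T_r$ with $i\in T_r$, where $T_j=T_{j-1}\cup\{i_j\}$ and $(S,i_j)\in\mathcal{S}$ for some $S\subseteq T_{j-1}$. The span of $T$ is the set of elements derivable from $T$; the rank $R(\mathcal{S})$ is the minimum size of a subset of $U$ whose span is $U$. The product $\mathcal{S}_1\otimes\mathcal{S}_2$ is the spanoid on $U_1\times U_2$ with inference rules: if $(S,i)\in\mathcal{S}_1$ then $(S\times\{j\},(i,j))\in\mathcal{S}_1\otimes\mathcal{S}_2$ for every $j\in U_2$; if $(S,j)\in\mathcal{S}_2$ then $(\{i\}\times S,(i,j))\in\mathcal{S}_1\otimes\mathcal{S}_2$ for every $i\in U_1$. -}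

module Defs where

open import Data.Nat using (ℕ; zero; suc; _*_; _≤_)
open import Data.Bool using (Bool; true; false; _∧_; if_then_else_)
open import Data.Fin using (Fin; remQuot)
open Fin
open import Data.Fin.Subset using (Subset; ⊥; ⁅_⁆; _∪_; _∈_; _⊆_; ∣_∣)
open import Data.Vec using (lookup; tabulate; sum)
open import Data.Product using (Σ; ∃; _×_; _,_; proj₁; proj₂)
open import Data.Sum using (_⊎_)
open import Function using (_∘_)

Rules : ℕ → Set₁
Rules n = Subset n → Fin n → Set

record Spanoid (n : ℕ) : Set₁ where
  field
    Rule    : Rules n
    trivial : ∀ i → Rule ⁅ i ⁆ i
    mono    : ∀ {S S′ i} → Rule S i → S ⊆ S′ → Rule S′ i
open Spanoid public

data Chain {n : ℕ} (R : Rules n) (T : Subset n) : Subset n → Set where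
  start : Chain R T T
  step  : ∀ {T′ S j} → Chain R T T′ → S ⊆ T′ → R S j → Chain R T (T′ ∪ ⁅ j ⁆)

Derivable : ∀ {n} → Rules n → Subset n → Fin n → Set
Derivable R T i = ∃ λ T′ → Chain R T T′ × i ∈ T′

SpansAll : ∀ {n} → Rules n → Subset n → Set
SpansAll R T = ∀ i → Derivable R T i

RankAtMost : ∀ {n} → Rules n → ℕ → Set
RankAtMost R k = ∃ λ T → SpansAll R T × ∣ T ∣ ≤ k

-- U₁ × U₂ is encoded as Fin (n₁ * n₂) via remQuot / combine.
_×ˢ_ : ∀ {n₁ n₂} → Subset n₁ → Subset n₂ → Subset (n₁ * n₂)
_×ˢ_ {n₁} {n₂} A B =
  tabulate λ k → lookup A (proj₁ (remQuot {n₁} n₂ k)) ∧ lookup B (proj₂ (remQuot {n₁} n₂ k))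

-- Inference rules of the product spanoid 𝒮₁ ⊗ 𝒮₂ (closed upward, which
-- does not change spans).
_⊗_ : ∀ {n₁ n₂} → Spanoid n₁ → Spanoid n₂ → Rules (n₁ * n₂)
_⊗_ {n₁} {n₂} 𝒮₁ 𝒮₂ S k =
    (Σ (Subset n₁) λ S₁ → Rule 𝒮₁ S₁ (proj₁ (remQuot {n₁} n₂ k))
                         × (_×ˢ_ {n₁} {n₂} S₁ ⁅ proj₂ (remQuot {n₁} n₂ k) ⁆) ⊆ S)
  ⊎ (Σ (Subset n₂) λ S₂ → Rule 𝒮₂ S₂ (proj₂ (remQuot {n₁} n₂ k))
                         × (_×ˢ_ {n₁} {n₂} ⁅ proj₁ (remQuot {n₁} n₂ k) ⁆ S₂) ⊆ S)

bigUnion : ∀ {n s} → (Fin s → Bool) → (Fin s → Subset n) → Subset n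
bigUnion {s = zero}  p N = ⊥
bigUnion {s = suc s} p N =
  (if p zero then N zero else ⊥) ∪ bigUnion (p ∘ suc) (N ∘ suc)

-- The union of rectangles T = ⋃ₜ Mₜ × Nₜ has at most Σₜ |Mₜ|·|Nₜ| elements. For each i ∈ U₁ the
-- row {i} × U₂ of T contains {i} × ⋃_{t : i ∈ Mₜ} Nₜ, whose second coordinates span U₂ in 𝒮₂; and
-- every 𝒮₂-derivation can be replayed inside a fixed row of 𝒮₁ ⊗ 𝒮₂ by the rules of the second kind.
-- So T spans U₁ × U₂.
module Submission where

open import Defs
open import Data.Nat using (ℕ; zero; suc; _+_; _*_; _≤_; s≤s)
open import Data.Nat.Properties using (≤-refl; ≤-trans; ≤-reflexive; +-mono-≤; +-monoʳ-≤; +-suc; n≤1+n)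
open import Data.Bool using (Bool; true; false; _∧_; if_then_else_)
open import Data.Fin using (Fin; zero; suc; remQuot; combine; _↑ˡ_; _↑ʳ_)
open import Data.Fin.Properties using (remQuot-combine; combine-remQuot; splitAt-↑ʳ)
open import Data.Fin.Subset using (Subset; ⊥; ⁅_⁆; _∪_; _∈_; _⊆_; ∣_∣)
open import Data.Fin.Subset.Properties
  using (∉⊥; ⊥⊆; ⊆-refl; ⊆-trans; p⊆q⇒∣p∣≤∣q∣; x∈p∪q⁺; x∈p∪q⁻; x∈⁅x⁆; x∈⁅y⁆⇒x≡y; ∣⊥∣≡0)
open import Data.Vec using ([]; _∷_; _++_; lookup; tabulate; sum)
open import Data.Vec.Properties
  using (lookup∘tabulate; tabulate∘lookup; tabulate-cong; lookup-replicate; []=⇒lookup; lookup⇒[]=)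
open import Data.Product using (∃; _×_; _,_; proj₁; proj₂; map₁)
open import Data.Sum using (inj₁; inj₂)
open import Data.Empty using (⊥-elim)
open import Function using (_∘_)
open import Relation.Binary.PropositionalEquality
open ≡-Reasoning

∧-≡true⁻ : ∀ {a b} → a ∧ b ≡ true → a ≡ true × b ≡ true
∧-≡true⁻ {true}  {true}  refl = refl , refl
∧-≡true⁻ {true}  {false} ()
∧-≡true⁻ {false}         ()

tabulate-++ : ∀ {A : Set} m {n} (f : Fin (m + n) → A) →
  tabulate f ≡ tabulate (f ∘ (_↑ˡ n)) ++ tabulate (f ∘ (m ↑ʳ_))
tabulate-++ zero    f = refl
tabulate-++ (suc m) f = cong (f zero ∷_) (tabulate-++ m (f ∘ suc))

∣p++q∣≡∣p∣+∣q∣ : ∀ {m n} (p : Subset m) (q : Subset n) → ∣ p ++ q ∣ ≡ ∣ p ∣ + ∣ q ∣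
∣p++q∣≡∣p∣+∣q∣ []          q = refl
∣p++q∣≡∣p∣+∣q∣ (true  ∷ p) q = cong suc (∣p++q∣≡∣p∣+∣q∣ p q)
∣p++q∣≡∣p∣+∣q∣ (false ∷ p) q = ∣p++q∣≡∣p∣+∣q∣ p q

∣p∪q∣≤∣p∣+∣q∣ : ∀ {n} (p q : Subset n) → ∣ p ∪ q ∣ ≤ ∣ p ∣ + ∣ q ∣
∣p∪q∣≤∣p∣+∣q∣ []          []          = ≤-refl
∣p∪q∣≤∣p∣+∣q∣ (true  ∷ p) (true  ∷ q) = s≤s (≤-trans (∣p∪q∣≤∣p∣+∣q∣ p q) (+-monoʳ-≤ ∣ p ∣ (n≤1+n ∣ q ∣)))
∣p∪q∣≤∣p∣+∣q∣ (true  ∷ p) (false ∷ q) = s≤s (∣p∪q∣≤∣p∣+∣q∣ p q)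
∣p∪q∣≤∣p∣+∣q∣ (false ∷ p) (true  ∷ q) = ≤-trans (s≤s (∣p∪q∣≤∣p∣+∣q∣ p q)) (≤-reflexive (sym (+-suc ∣ p ∣ ∣ q ∣)))
∣p∪q∣≤∣p∣+∣q∣ (false ∷ p) (false ∷ q) = ∣p∪q∣≤∣p∣+∣q∣ p q

remQuot-↑ʳ : ∀ {m} n (k : Fin (m * n)) → remQuot {suc m} n (n ↑ʳ k) ≡ map₁ suc (remQuot {m} n k)
remQuot-↑ʳ {m} n k rewrite splitAt-↑ʳ n (m * n) k = refl

module _ {n₁ n₂ : ℕ} where

  lookup-×ˢ : ∀ (A : Subset n₁) (B : Subset n₂) i j →
    lookup (A ×ˢ B) (combine i j) ≡ lookup A i ∧ lookup B j
  lookup-×ˢ A B i j = begin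
    lookup (A ×ˢ B) (combine i j)
      ≡⟨ lookup∘tabulate _ (combine i j) ⟩
    lookup A (proj₁ (remQuot {n₁} n₂ (combine i j))) ∧ lookup B (proj₂ (remQuot {n₁} n₂ (combine i j)))
      ≡⟨ cong (λ (i′ , j′) → lookup A i′ ∧ lookup B j′) (remQuot-combine i j) ⟩
    lookup A i ∧ lookup B j
      ∎

  ∈-×ˢ⁺ : ∀ {A : Subset n₁} {B : Subset n₂} {i j} → i ∈ A → j ∈ B → combine i j ∈ A ×ˢ B
  ∈-×ˢ⁺ {A} {B} {i} {j} i∈A j∈B =
    lookup⇒[]= (combine i j) (A ×ˢ B) (trans (lookup-×ˢ A B i j) (cong₂ _∧_ ([]=⇒lookup i∈A) ([]=⇒lookup j∈B)))

  ∈-×ˢ⁻ : ∀ {A : Subset n₁} {B : Subset n₂} {i j} → combine i j ∈ A ×ˢ B → i ∈ A × j ∈ B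
  ∈-×ˢ⁻ {A} {B} {i} {j} ij∈A×B
    with ∧-≡true⁻ (trans (sym (lookup-×ˢ A B i j)) ([]=⇒lookup ij∈A×B))
  ... | A[i] , B[j] = lookup⇒[]= i A A[i] , lookup⇒[]= j B B[j]

  ×ˢ-⊆ : ∀ (A : Subset n₁) (B : Subset n₂) {T} →
    (∀ {i j} → i ∈ A → j ∈ B → combine i j ∈ T) → A ×ˢ B ⊆ T
  ×ˢ-⊆ A B {T} h {k} k∈A×B = subst (_∈ T) (combine-remQuot {n₁} n₂ k)
    (let i∈A , j∈B = ∈-×ˢ⁻ (subst (_∈ A ×ˢ B) (sym (combine-remQuot {n₁} n₂ k)) k∈A×B) in h i∈A j∈B)

  ×ˢ-monoʳ : ∀ (A : Subset n₁) {B B′ : Subset n₂} → B ⊆ B′ → A ×ˢ B ⊆ A ×ˢ B′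
  ×ˢ-monoʳ A {B} B⊆B′ = ×ˢ-⊆ A B λ i∈A j∈B → ∈-×ˢ⁺ i∈A (B⊆B′ j∈B)

  ⁅⁆×ˢ-⊆ : ∀ i {B : Subset n₂} {T} → (∀ {j} → j ∈ B → combine i j ∈ T) → ⁅ i ⁆ ×ˢ B ⊆ T
  ⁅⁆×ˢ-⊆ i {B} {T} h = ×ˢ-⊆ ⁅ i ⁆ B λ i′∈⁅i⁆ j∈B →
    subst (λ i′ → combine i′ _ ∈ T) (sym (x∈⁅y⁆⇒x≡y _ i′∈⁅i⁆)) (h j∈B)

-- combine enumerates U₁ × U₂ row by row, so the first n₂ indices of Fin (suc n₁ * n₂) form row zero.
×ˢ-∷ : ∀ {n₁ n₂} a (A : Subset n₁) (B : Subset n₂) →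
  (a ∷ A) ×ˢ B ≡ (if a then B else ⊥) ++ (A ×ˢ B)
×ˢ-∷ {n₁} {n₂} a A B = begin
  tabulate f                                                 ≡⟨ tabulate-++ n₂ f ⟩
  tabulate (f ∘ (_↑ˡ n₁ * n₂)) ++ tabulate (f ∘ (n₂ ↑ʳ_))    ≡⟨ cong₂ _++_ firstRow (tabulate-cong otherRows) ⟩
  (if a then B else ⊥) ++ (A ×ˢ B)                           ∎
  where
  f : Fin (suc n₁ * n₂) → Bool
  f k = lookup (a ∷ A) (proj₁ (remQuot {suc n₁} n₂ k)) ∧ lookup B (proj₂ (remQuot {suc n₁} n₂ k))

  entry : ∀ b j → b ∧ lookup B j ≡ lookup (if b then B else ⊥) j
  entry true  j = refl
  entry false j = sym (lookup-replicate j false)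

  firstRow : tabulate (f ∘ (_↑ˡ n₁ * n₂)) ≡ (if a then B else ⊥)
  firstRow = trans (tabulate-cong λ j → trans (cong (λ (i , j′) → lookup (a ∷ A) i ∧ lookup B j′)
                                                    (remQuot-combine zero j))
                                              (entry a j))
                   (tabulate∘lookup _)

  otherRows : ∀ k → f (n₂ ↑ʳ k) ≡ lookup A (proj₁ (remQuot {n₁} n₂ k)) ∧ lookup B (proj₂ (remQuot {n₁} n₂ k))
  otherRows k = cong (λ (i , j) → lookup (a ∷ A) i ∧ lookup B j) (remQuot-↑ʳ n₂ k)

∣A×ˢB∣≡∣A∣*∣B∣ : ∀ {n₁ n₂} (A : Subset n₁) (B : Subset n₂) → ∣ A ×ˢ B ∣ ≡ ∣ A ∣ * ∣ B ∣
∣A×ˢB∣≡∣A∣*∣B∣ []          B = refl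
∣A×ˢB∣≡∣A∣*∣B∣ (true  ∷ A) B = begin
  ∣ (true ∷ A) ×ˢ B ∣   ≡⟨ cong ∣_∣ (×ˢ-∷ true A B) ⟩
  ∣ B ++ A ×ˢ B ∣       ≡⟨ ∣p++q∣≡∣p∣+∣q∣ B (A ×ˢ B) ⟩
  ∣ B ∣ + ∣ A ×ˢ B ∣    ≡⟨ cong (∣ B ∣ +_) (∣A×ˢB∣≡∣A∣*∣B∣ A B) ⟩
  ∣ B ∣ + ∣ A ∣ * ∣ B ∣ ∎
∣A×ˢB∣≡∣A∣*∣B∣ {n₂ = n₂} (false ∷ A) B = begin
  ∣ (false ∷ A) ×ˢ B ∣  ≡⟨ cong ∣_∣ (×ˢ-∷ false A B) ⟩
  ∣ ⊥ {n₂} ++ A ×ˢ B ∣  ≡⟨ ∣p++q∣≡∣p∣+∣q∣ (⊥ {n₂}) (A ×ˢ B) ⟩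
  ∣ ⊥ {n₂} ∣ + ∣ A ×ˢ B ∣ ≡⟨ cong₂ _+_ (∣⊥∣≡0 n₂) (∣A×ˢB∣≡∣A∣*∣B∣ A B) ⟩
  ∣ A ∣ * ∣ B ∣         ∎

∈-bigUnion⁺ : ∀ {n s} (p : Fin s → Bool) (N : Fin s → Subset n) {t j} →
  p t ≡ true → j ∈ N t → j ∈ bigUnion p N
∈-bigUnion⁺ p N {zero}  p[t] j∈N =
  x∈p∪q⁺ (inj₁ (subst (λ b → _ ∈ (if b then N zero else ⊥)) (sym p[t]) j∈N))
∈-bigUnion⁺ p N {suc t} p[t] j∈N = x∈p∪q⁺ (inj₂ (∈-bigUnion⁺ (p ∘ suc) (N ∘ suc) p[t] j∈N))

∈-bigUnion⁻ : ∀ {n s} (p : Fin s → Bool) (N : Fin s → Subset n) {j} →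
  j ∈ bigUnion p N → ∃ λ t → p t ≡ true × j ∈ N t
∈-bigUnion⁻ {s = zero}  p N j∈ = ⊥-elim (∉⊥ j∈)
∈-bigUnion⁻ {s = suc s} p N j∈ with x∈p∪q⁻ _ (bigUnion (p ∘ suc) (N ∘ suc)) j∈
... | inj₂ j∈rest = let t , p[t] , j∈N = ∈-bigUnion⁻ (p ∘ suc) (N ∘ suc) j∈rest in suc t , p[t] , j∈N
... | inj₁ j∈first with p zero in p[0]
...   | true  = zero , p[0] , j∈first
...   | false = ⊥-elim (∉⊥ j∈first)

∣bigUnion∣≤sum : ∀ {n s} (p : Fin s → Bool) (N : Fin s → Subset n) →
  ∣ bigUnion p N ∣ ≤ sum (tabulate (∣_∣ ∘ N))
∣bigUnion∣≤sum {n} {zero}  p N = ≤-reflexive (∣⊥∣≡0 n)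
∣bigUnion∣≤sum {n} {suc s} p N =
  ≤-trans (∣p∪q∣≤∣p∣+∣q∣ (if p zero then N zero else ⊥) (bigUnion (p ∘ suc) (N ∘ suc)))
          (+-mono-≤ (first (p zero)) (∣bigUnion∣≤sum (p ∘ suc) (N ∘ suc)))
  where
  first : ∀ b → ∣ if b then N zero else ⊥ ∣ ≤ ∣ N zero ∣
  first true  = ≤-refl
  first false = p⊆q⇒∣p∣≤∣q∣ (⊥⊆ {p = N zero})

rectangles : ∀ {n₁ n₂ s} → (Fin s → Subset n₁) → (Fin s → Subset n₂) → Subset (n₁ * n₂)
rectangles M N = bigUnion (λ _ → true) (λ t → M t ×ˢ N t)

∣rectangles∣≤ : ∀ {n₁ n₂ s} (M : Fin s → Subset n₁) (N : Fin s → Subset n₂) →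
  ∣ rectangles M N ∣ ≤ sum (tabulate (λ t → ∣ M t ∣ * ∣ N t ∣))
∣rectangles∣≤ M N = ≤-trans (∣bigUnion∣≤sum _ (λ t → M t ×ˢ N t))
  (≤-reflexive (cong sum (tabulate-cong λ t → ∣A×ˢB∣≡∣A∣*∣B∣ (M t) (N t))))

module _ {n₁ n₂ : ℕ} (𝒮₁ : Spanoid n₁) (𝒮₂ : Spanoid n₂) where

  ⊗-rowRule : ∀ {S j} (i : Fin n₁) → Rule 𝒮₂ S j → (𝒮₁ ⊗ 𝒮₂) (⁅ i ⁆ ×ˢ S) (combine i j)
  ⊗-rowRule {S} {j} i r = inj₂ (S , subst (Rule 𝒮₂ S) (sym (cong proj₂ ij)) r
                                  , subst (λ i′ → ⁅ i′ ⁆ ×ˢ S ⊆ ⁅ i ⁆ ×ˢ S) (sym (cong proj₁ ij)) ⊆-refl)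
    where
    ij : remQuot {n₁} n₂ (combine i j) ≡ (i , j)
    ij = remQuot-combine i j

  Chain-row : ∀ (i : Fin n₁) {B B′ T} → Chain (Rule 𝒮₂) B B′ → ⁅ i ⁆ ×ˢ B ⊆ T →
    ∃ λ T′ → Chain (𝒮₁ ⊗ 𝒮₂) T T′ × ⁅ i ⁆ ×ˢ B′ ⊆ T′
  Chain-row i start row = _ , start , row
  Chain-row i (step {T′ = B} {j = j} ch S⊆B r) row with Chain-row i ch row
  ... | T , ch′ , rowB⊆T = T ∪ ⁅ combine i j ⁆
                         , step ch′ (⊆-trans (×ˢ-monoʳ ⁅ i ⁆ S⊆B) rowB⊆T) (⊗-rowRule i r)
                         , ⁅⁆×ˢ-⊆ i extend
    where
    extend : ∀ {j′} → j′ ∈ B ∪ ⁅ j ⁆ → combine i j′ ∈ T ∪ ⁅ combine i j ⁆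
    extend j′∈ with x∈p∪q⁻ B ⁅ j ⁆ j′∈
    ... | inj₁ j′∈B   = x∈p∪q⁺ (inj₁ (rowB⊆T (∈-×ˢ⁺ (x∈⁅x⁆ i) j′∈B)))
    ... | inj₂ j′∈⁅j⁆ rewrite x∈⁅y⁆⇒x≡y j j′∈⁅j⁆ = x∈p∪q⁺ (inj₂ (x∈⁅x⁆ (combine i j)))

  Derivable-row : ∀ (i : Fin n₁) {B T j} → Derivable (Rule 𝒮₂) B j → ⁅ i ⁆ ×ˢ B ⊆ T →
    Derivable (𝒮₁ ⊗ 𝒮₂) T (combine i j)
  Derivable-row i (B′ , ch , j∈B′) row with Chain-row i ch row
  ... | T′ , ch′ , rowB′⊆T′ = T′ , ch′ , rowB′⊆T′ (∈-×ˢ⁺ (x∈⁅x⁆ i) j∈B′)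

  SpansAll-rows : ∀ (B : Fin n₁ → Subset n₂) {T} → (∀ i → SpansAll (Rule 𝒮₂) (B i)) →
    (∀ i → ⁅ i ⁆ ×ˢ B i ⊆ T) → SpansAll (𝒮₁ ⊗ 𝒮₂) T
  SpansAll-rows B {T} spans rows k = subst (Derivable (𝒮₁ ⊗ 𝒮₂) T) (combine-remQuot {n₁} n₂ k)
    (let i , j = remQuot {n₁} n₂ k in Derivable-row i (spans i j) (rows i))

row⊆rectangles : ∀ {n₁ n₂ s} (M : Fin s → Subset n₁) (N : Fin s → Subset n₂) i →
  ⁅ i ⁆ ×ˢ bigUnion (λ t → lookup (M t) i) N ⊆ rectangles M N
row⊆rectangles M N i = ⁅⁆×ˢ-⊆ i λ j∈ →
  let t , i∈M , j∈N = ∈-bigUnion⁻ (λ t → lookup (M t) i) N j∈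
  in ∈-bigUnion⁺ _ (λ t → M t ×ˢ N t) refl (∈-×ˢ⁺ (lookup⇒[]= i (M t) i∈M) j∈N)

theorem7 : ∀ {n₁ n₂ : ℕ} (𝒮₁ : Spanoid n₁) (𝒮₂ : Spanoid n₂) (s : ℕ)
    (M : Fin s → Subset n₁) (N : Fin s → Subset n₂) →
    (∀ (i : Fin n₁) → SpansAll (Rule 𝒮₂) (bigUnion (λ t → lookup (M t) i) N)) →
    RankAtMost (𝒮₁ ⊗ 𝒮₂) (sum (tabulate (λ t → ∣ M t ∣ * ∣ N t ∣)))
theorem7 𝒮₁ 𝒮₂ s M N spans =
    rectangles M N
  , SpansAll-rows 𝒮₁ 𝒮₂ (λ i → bigUnion (λ t → lookup (M t) i) N) spans (row⊆rectangles M N)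
  , ∣rectangles∣≤ M N
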